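{- Let $\ell\ge2$ be an integer and let $x<y$ be consecutive elements of $\overline{\mathcal{V}}_\ell$. Then $\{x,y\}\not\subseteq\overline{\mathcal{V}}_{\ell+2}$, $\{x,y\}\cap\overline{\mathcal{V}}_{\ell+1}\ne\emptyset$, and $|\bar\alpha(y)-\bar\alpha(x)|\ge y-x$.
   Context: Fibonacci numbers: $F_{ -1}=0$, $F_0=1$, $F_{i+2}=F_{i+1}+F_i$; $\overline{\mathcal{F}}=\{F_i: i\ge-1\}$. Define $\bar\iota:\mathbb{N}\to\mathbb{N}$ by $\bar\iota(x)=x$ if $x\in\overline{\mathcal{F}}$, and $\bar\iota(x)=x-2F_{i-2}$ if $F_i<x<F_{i+1}$ for an integer $i\ge3$; $\bar\alpha(x)=\lim_k\bar\iota^k(x)$; $\overline{\mathcal{V}}_\ell=\{x\in\mathbb{N}: \bar\alpha(x)\ge F_\ell\}$. Elements $x<y$ of $\overline{\mathcal{V}}_\ell$ are consecutive if no element of $\overline{\mathcal{V}}_\ell$ lies strictly between them. -}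

module Defs where

open import Data.Nat using (ℕ; zero; suc; _+_; _*_; _∸_; _≤_; _<_; _<?_; _≤?_)
open import Data.Product using (Σ; ∃; _×_)
open import Relation.Nullary using (¬_; yes; no)
open import Relation.Binary.PropositionalEquality using (_≡_)
open import Function using (_∘_)

-- Fibonacci numbers with the paper's indexing, for indices i ≥ 0:
-- F i = F_i, with F_0 = 1, F_1 = 1, F_{i+2} = F_{i+1} + F_i.
-- (F_{-1} = 0 is never needed as an index below: it only matters for
--  x = 0 ∈ \bar{F}, which the search in ιbar handles: ιbar 0 = 0.)
F : ℕ → ℕ
F zero = 1
F (suc zero) = 1
F (suc (suc i)) = F (suc i) + F i

-- Search for the least i (starting from the current one) with x < F (i+1);
-- then F i ≤ x.
-- Fuel x+1 suffices since F (i+1) > i.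
ιaux : ℕ → ℕ → ℕ → ℕ
ιaux zero i x = x
ιaux (suc f) i x with x <? F (suc i)
... | no _ = ιaux f (suc i) x
... | yes _ with F i <? x | 3 ≤? i
...   | yes _ | yes _ = x ∸ 2 * F (i ∸ 2)
...   | _     | _     = x

ιbar : ℕ → ℕ
ιbar x = ιaux (suc x) 0 x

iter : ℕ → (ℕ → ℕ) → ℕ → ℕ
iter zero g x = x
iter (suc k) g x = g (iter k g x)

-- "\bar{α}(x) = a": a is the limit of the sequence ιbar^k(x), i.e. the
-- sequence is eventually constantly equal to a (limits in ℕ, discrete).
AlphaIs : ℕ → ℕ → Set
AlphaIs x a = Σ ℕ λ k → ∀ j → k ≤ j → iter j ιbar x ≡ a

V : ℕ → ℕ → Set
V ℓ x = Σ ℕ λ a → AlphaIs x a × F ℓ ≤ a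

Consecutive : ℕ → ℕ → ℕ → Set
Consecutive ℓ x y = x < y × V ℓ x × V ℓ y × (∀ z → x < z → z < y → ¬ V ℓ z)

{-# OPTIONS --safe #-}
module Submission where

-- Call [F k, F (1 + k)) block k.  ιbar maps the interior point F (3 + j) + t of
-- block 3 + j to F j + t, so α is unchanged by this lowering, and a consecutive pair
-- inside one block can be lowered, keeping α x, α y and y − x, until one of its ends
-- is a Fibonacci number.  For such pairs the gap bound follows from α z + z ≤ 2 F k on
-- block k when x = F k, and from α z ≤ z when y = F (1 + k).  An end lies in V (ℓ + 1)
-- because it is F k with k > ℓ, or, when x = F ℓ, because block ℓ has no interior
-- point of V ℓ.  The other end is not in V (ℓ + 2) because the neighbours of F k in
-- V ℓ lie within margins on which α stays below F (ℓ + 2); such margins are exhibited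
-- for k = ℓ, ℓ + 1, ℓ + 2 and carried from block k to block k + 3 by the same lowering.

open import Defs
open import Data.Nat using (ℕ; _+_; _∸_; _≤_; ∣_-_∣)
open import Data.Product using (_×_)
open import Data.Sum using (_⊎_)
open import Relation.Nullary using (¬_)

open import Data.Nat using (zero; suc; _*_; _<_; _<?_; _≤?_; z≤n; s≤s; s≤s⁻¹)
open import Data.Nat.Properties
open import Data.Nat.Induction using (<-rec)
open import Data.Nat.Tactic.RingSolver using (solve-∀)
open import Data.Product using (∃-syntax; _,_; proj₁)
open import Data.Sum using (inj₁; inj₂; [_,_]; map)
open import Relation.Nullary using (yes; no; contradiction)
open import Relation.Binary.PropositionalEquality
  using (_≡_; refl; sym; trans; cong; subst; subst₂; module ≡-Reasoning)

F-pos : ∀ n → 0 < F n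
F-pos zero = s≤s z≤n
F-pos (suc zero) = s≤s z≤n
F-pos (suc (suc n)) = ≤-trans (F-pos (suc n)) (m≤m+n _ _)

F-≤-suc : ∀ n → F n ≤ F (suc n)
F-≤-suc zero = ≤-refl
F-≤-suc (suc n) = m≤m+n _ _

F-<-suc : ∀ n → F (1 + n) < F (2 + n)
F-<-suc n = m<m+n (F (1 + n)) (F-pos n)

F-mono-≤ : ∀ {i j} → i ≤ j → F i ≤ F j
F-mono-≤ {j = zero} z≤n = ≤-refl
F-mono-≤ {j = suc j} i≤1+j with m≤n⇒m<n∨m≡n i≤1+j
... | inj₁ (s≤s i≤j) = ≤-trans (F-mono-≤ i≤j) (F-≤-suc j)
... | inj₂ refl = ≤-refl

F-mono-< : ∀ {i j} → 2 + i ≤ j → F i < F j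
F-mono-< {i} 2+i≤j = <-≤-trans (≤-<-trans (F-≤-suc i) (F-<-suc i)) (F-mono-≤ 2+i≤j)

F-cancel-< : ∀ {i j} → F i < F j → i < j
F-cancel-< {i} {j} Fi<Fj with i <? j
... | yes i<j = i<j
... | no i≮j = contradiction (F-mono-≤ {j} {i} (≮⇒≥ i≮j)) (<⇒≱ Fi<Fj)

n≤F : ∀ n → n ≤ F n
n≤F zero = z≤n
n≤F (suc zero) = ≤-refl
n≤F (suc (suc n)) = subst (_≤ F (2 + n)) (+-comm (suc n) 1) (+-mono-≤ (n≤F (suc n)) (F-pos n))

block-of : ∀ x → 0 < x → ∃[ k ] F k ≤ x × x < F (1 + k)
block-of (suc zero) _ = 1 , ≤-refl , s≤s (s≤s z≤n)
block-of (suc (suc x)) _ with block-of (suc x) (s≤s z≤n)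
... | k , Fk≤x , x<F with m≤n⇒m<n∨m≡n x<F
...   | inj₁ 2+x<F = k , m≤n⇒m≤1+n Fk≤x , 2+x<F
...   | inj₂ 2+x≡F = 1 + k , ≤-reflexive (sym 2+x≡F) , subst (_< F (2 + k)) (sym 2+x≡F) (F-<-suc k)

∃-offset : ∀ b {s t z} → b + s < z → z < b + t → ∃[ u ] z ≡ b + u × s < u × u < t
∃-offset b {s} {t} {z} lo hi =
  z ∸ b , sym b+u≡z ,
  +-cancelˡ-< b s (z ∸ b) (subst (b + s <_) (sym b+u≡z) lo) ,
  +-cancelˡ-< b (z ∸ b) t (subst (_< b + t) (sym b+u≡z) hi)
  where
  b+u≡z : b + (z ∸ b) ≡ z
  b+u≡z = m+[n∸m]≡n (≤-trans (m≤m+n b s) (<⇒≤ lo))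

-- Points F k < z < F (1 + k) inside block k; blocks 0, 1 and 2 have none.
data Interior : ℕ → ℕ → Set where
  interior : ∀ j t → 0 < t → t < F (2 + j) → Interior (3 + j) (F (3 + j) + t)

interior-view : ∀ {k z} → F k < z → z < F (1 + k) → Interior k z
interior-view {0} Fk<z z<F = contradiction Fk<z (<-asym z<F)
interior-view {1} Fk<z z<F = contradiction Fk<z (<⇒≱ z<F)
interior-view {2} Fk<z z<F = contradiction Fk<z (<⇒≱ z<F)
interior-view {suc (suc (suc j))} {z} Fk<z z<F
  with ∃-offset (F (3 + j)) (subst (_< z) (sym (+-identityʳ (F (3 + j)))) Fk<z) z<F
... | t , refl , 0<t , t< = interior j t 0<t t<

F[j]+t<F[3+j] : ∀ j {t} → t < F (2 + j) → F j + t < F (3 + j)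
F[j]+t<F[3+j] j {t} t< = begin-strict
  F j + t               <⟨ +-monoʳ-< (F j) t< ⟩
  F j + F (2 + j)       ≤⟨ +-monoˡ-≤ (F (2 + j)) (F-≤-suc j) ⟩
  F (1 + j) + F (2 + j) ≡⟨ +-comm (F (1 + j)) (F (2 + j)) ⟩
  F (3 + j)             ∎
  where open ≤-Reasoning

ιaux-≤ : ∀ f i x → ιaux f i x ≤ x
ιaux-≤ zero i x = ≤-refl
ιaux-≤ (suc f) i x with x <? F (suc i)
... | no _ = ιaux-≤ f (suc i) x
... | yes _ with F i <? x | 3 ≤? i
...   | yes _ | yes _ = m∸n≤m x (2 * F (i ∸ 2))
...   | yes _ | no _ = ≤-refl
...   | no _ | _ = ≤-refl

ιbar-≤ : ∀ x → ιbar x ≤ x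
ιbar-≤ x = ιaux-≤ (suc x) 0 x

ιaux-stop : ∀ f {k x} → x < F (suc k) → ιaux (suc f) k x ≡ ιaux 1 k x
ιaux-stop f {k} {x} x<F with x <? F (suc k)
... | no x≮F = contradiction x<F x≮F
... | yes _ with F k <? x | 3 ≤? k
...   | yes _ | yes _ = refl
...   | yes _ | no _ = refl
...   | no _ | _ = refl

ιaux-search : ∀ f {i k x} → i ≤ k → k < i + f → F k ≤ x → x < F (suc k)
  → ιaux f i x ≡ ιaux 1 k x
ιaux-search zero {i} i≤k k<i+0 _ _ = contradiction (subst (_ <_) (+-identityʳ i) k<i+0) (≤⇒≯ i≤k)
ιaux-search (suc f) {i} {k} {x} i≤k k<i+f Fk≤x x<F with m≤n⇒m<n∨m≡n i≤k
... | inj₂ refl = ιaux-stop f {k} x<F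
... | inj₁ i<k with x <? F (suc i)
...   | yes x<F[1+i] = contradiction (≤-trans (F-mono-≤ i<k) Fk≤x) (<⇒≱ x<F[1+i])
...   | no _ = ιaux-search f i<k (subst (k <_) (+-suc i f) k<i+f) Fk≤x x<F

-- ιaux 1 k x runs only the last step of the search in ιbar, the one at block k.
ιbar-block : ∀ {k x} → F k ≤ x → x < F (suc k) → ιbar x ≡ ιaux 1 k x
ιbar-block {k} {x} Fk≤x x<F = ιaux-search (suc x) z≤n (s≤s (≤-trans (n≤F k) Fk≤x)) Fk≤x x<F

ιaux-fixes : ∀ k {x} → ¬ F k < x → ιaux 1 k x ≡ x
ιaux-fixes k {x} Fk≮x with x <? F (suc k)
... | no _ = refl
... | yes _ with F k <? x | 3 ≤? k
...   | yes Fk<x | _ = contradiction Fk<x Fk≮x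
...   | no _ | _ = refl

ιaux-moves : ∀ k {x} → 3 ≤ k → F k < x → x < F (suc k) → ιaux 1 k x ≡ x ∸ 2 * F (k ∸ 2)
ιaux-moves k {x} 3≤k Fk<x x<F with x <? F (suc k)
... | no x≮F = contradiction x<F x≮F
... | yes _ with F k <? x | 3 ≤? k
...   | yes _ | yes _ = refl
...   | yes _ | no 3≰k = contradiction 3≤k 3≰k
...   | no Fk≮x | _ = contradiction Fk<x Fk≮x

ιbar-fib : ∀ i → ιbar (F i) ≡ F i
ιbar-fib zero = refl
ιbar-fib (suc i) = trans (ιbar-block {suc i} ≤-refl (F-<-suc i)) (ιaux-fixes (suc i) (<-irrefl refl))

ιbar-shift : ∀ j {t} → 0 < t → t < F (2 + j) → ιbar (F (3 + j) + t) ≡ F j + t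
ιbar-shift j {t} 0<t t< = begin
  ιbar (F (3 + j) + t)
    ≡⟨ ιbar-block {3 + j} (m≤m+n _ t) (+-monoʳ-< (F (3 + j)) t<) ⟩
  ιaux 1 (3 + j) (F (3 + j) + t)
    ≡⟨ ιaux-moves (3 + j) (s≤s (s≤s (s≤s z≤n))) (m<m+n _ 0<t) (+-monoʳ-< _ t<) ⟩
  F (3 + j) + t ∸ 2 * F (1 + j)
    ≡⟨ cong (_∸ 2 * F (1 + j)) (regroup (F (1 + j)) (F j) t) ⟩
  2 * F (1 + j) + (F j + t) ∸ 2 * F (1 + j)
    ≡⟨ m+n∸m≡n (2 * F (1 + j)) (F j + t) ⟩
  F j + t
    ∎
  where
  open ≡-Reasoning
  regroup : ∀ a b t → a + b + a + t ≡ 2 * a + (b + t)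
  regroup = solve-∀

iter-+ : ∀ m n (g : ℕ → ℕ) x → iter (m + n) g x ≡ iter m g (iter n g x)
iter-+ zero n g x = refl
iter-+ (suc m) n g x = cong g (iter-+ m n g x)

iter-fixed : ∀ {g : ℕ → ℕ} {z} → g z ≡ z → ∀ n → iter n g z ≡ z
iter-fixed gz≡z zero = refl
iter-fixed {g} gz≡z (suc n) = trans (cong g (iter-fixed gz≡z n)) gz≡z

iter-ιbar-≤ : ∀ n x → iter n ιbar x ≤ x
iter-ιbar-≤ zero x = ≤-refl
iter-ιbar-≤ (suc n) x = ≤-trans (ιbar-≤ _) (iter-ιbar-≤ n x)

ιbar-settles : ∀ n x → ιbar (iter n ιbar x) ≡ iter n ιbar x ⊎ n + iter n ιbar x ≤ x
ιbar-settles zero x = inj₂ ≤-refl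
ιbar-settles (suc n) x with m≤n⇒m<n∨m≡n (ιbar-≤ (iter n ιbar x)) | ιbar-settles n x
... | inj₂ fixed | _ = inj₁ (cong ιbar fixed)
... | inj₁ lowered | inj₁ fixed = contradiction fixed (<⇒≢ lowered)
... | inj₁ lowered | inj₂ n+z≤x = inj₂ (≤-trans (+-monoʳ-< n lowered) n+z≤x)

-- Every point that ιbar does not fix is lowered, so x iterations reach the limit.
α : ℕ → ℕ
α x = iter x ιbar x

ιbar-α : ∀ x → ιbar (α x) ≡ α x
ιbar-α x with ιbar-settles x x
... | inj₁ fixed = fixed
... | inj₂ x+αx≤x = subst (λ z → ιbar z ≡ z) (sym αx≡0) refl
  where
  αx≡0 : α x ≡ 0
  αx≡0 = n≤0⇒n≡0 (+-cancelˡ-≤ x (α x) 0 (subst (x + α x ≤_) (sym (+-identityʳ x)) x+αx≤x))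

iter-ιbar-beyond : ∀ {x j} → x ≤ j → iter j ιbar x ≡ α x
iter-ιbar-beyond {x} {j} x≤j = begin
  iter j ιbar x               ≡⟨ cong (λ n → iter n ιbar x) (sym (m∸n+n≡m x≤j)) ⟩
  iter (j ∸ x + x) ιbar x     ≡⟨ iter-+ (j ∸ x) x ιbar x ⟩
  iter (j ∸ x) ιbar (α x)     ≡⟨ iter-fixed (ιbar-α x) (j ∸ x) ⟩
  α x                         ∎
  where open ≡-Reasoning

α-spec : ∀ x → AlphaIs x (α x)
α-spec x = x , λ _ → iter-ιbar-beyond

AlphaIs⇒≡α : ∀ {x a} → AlphaIs x a → a ≡ α x
AlphaIs⇒≡α {x} {a} (k , eventually-a) = begin
  a                      ≡⟨ sym (eventually-a (k + x) (m≤m+n k x)) ⟩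
  iter (k + x) ιbar x    ≡⟨ iter-ιbar-beyond (m≤n+m x k) ⟩
  α x                    ∎
  where open ≡-Reasoning

α-≤ : ∀ x → α x ≤ x
α-≤ x = iter-ιbar-≤ x x

α-< : ∀ {x b} → x < b → α x < b
α-< = ≤-<-trans (α-≤ _)

α-ιbar : ∀ x → α (ιbar x) ≡ α x
α-ιbar x = sym (AlphaIs⇒≡α (x , λ j x≤j →
  trans (sym (iter-+ j 1 ιbar x)) (iter-ιbar-beyond (≤-trans x≤j (m≤m+n j 1)))))

α-fib : ∀ i → α (F i) ≡ F i
α-fib i = iter-fixed (ιbar-fib i) (F i)

α-shift : ∀ j {t} → 0 < t → t < F (2 + j) → α (F (3 + j) + t) ≡ α (F j + t)
α-shift j {t} 0<t t< = trans (sym (α-ιbar (F (3 + j) + t))) (cong α (ιbar-shift j 0<t t<))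

α-shiftʳ : ∀ k {e} → 0 < e → e < F k → α (F (4 + k) ∸ e) ≡ α (F (1 + k) ∸ e)
α-shiftʳ zero 0<e e<1 = contradiction 0<e (<⇒≱ e<1)
α-shiftʳ (suc n) {e} 0<e e<F = begin
  α (F (5 + n) ∸ e)
    ≡⟨ cong α (+-∸-assoc (F (4 + n)) (≤-trans e≤F (m≤n+m _ _))) ⟩
  α (F (4 + n) + (F (2 + n) + F (1 + n) ∸ e))
    ≡⟨ cong (λ w → α (F (4 + n) + w)) (+-∸-assoc (F (2 + n)) e≤F) ⟩
  α (F (4 + n) + (F (2 + n) + u))
    ≡⟨ α-shift (1 + n) (≤-trans (F-pos (2 + n)) (m≤m+n _ u)) (+-monoʳ-< (F (2 + n)) u<) ⟩
  α (F (1 + n) + (F (2 + n) + u))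
    ≡⟨ cong α (trans (sym (+-assoc (F (1 + n)) (F (2 + n)) u))
                     (cong (_+ u) (+-comm (F (1 + n)) (F (2 + n))))) ⟩
  α (F (3 + n) + u)
    ≡⟨ α-shift n (m<n⇒0<n∸m e<F) (<-≤-trans u< (F-≤-suc (1 + n))) ⟩
  α (F n + u)
    ≡⟨ cong α (trans (+-comm (F n) u) (sym (+-∸-comm (F n) e≤F))) ⟩
  α (F (2 + n) ∸ e)
    ∎
  where
  open ≡-Reasoning
  u : ℕ
  u = F (1 + n) ∸ e
  e≤F : e ≤ F (1 + n)
  e≤F = <⇒≤ e<F
  u< : u < F (1 + n)
  u< = ∸-monoʳ-< 0<e e≤F

α-interior : ∀ {k z} → F k < z → z < F (1 + k) → α z < F k
α-interior {k} Fk<z z<F with interior-view {k} Fk<z z<F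
... | interior j t 0<t t< = begin-strict
  α (F (3 + j) + t) ≡⟨ α-shift j 0<t t< ⟩
  α (F j + t)       ≤⟨ α-≤ (F j + t) ⟩
  F j + t           <⟨ F[j]+t<F[3+j] j t< ⟩
  F (3 + j)         ∎
  where open ≤-Reasoning

α-tent : ∀ i {z} → z < F (1 + i) → α z + z ≤ F i + F i
α-tent i {z} z<F with z ≤? F i
... | yes z≤Fi = +-mono-≤ (≤-trans (α-≤ z) z≤Fi) z≤Fi
... | no z≰Fi with interior-view {i} (≰⇒> z≰Fi) z<F
...   | interior j t 0<t t< = begin
  α (F (3 + j) + t) + (F (3 + j) + t)
    ≡⟨ cong (_+ (F (3 + j) + t)) (α-shift j 0<t t<) ⟩
  α w + (F (3 + j) + t)
    ≡⟨ regroup (α w) (F (1 + j)) (F j) t ⟩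
  α w + w + (F (1 + j) + F (1 + j))
    ≤⟨ +-monoˡ-≤ _ (α-tent (suc (suc j)) (F[j]+t<F[3+j] j t<)) ⟩
  F (2 + j) + F (2 + j) + (F (1 + j) + F (1 + j))
    ≡⟨ regroup′ (F (2 + j)) (F (1 + j)) ⟩
  F (3 + j) + F (3 + j)
    ∎
  where
  open ≤-Reasoning
  w : ℕ
  w = F j + t
  regroup : ∀ c a b t → c + (a + b + a + t) ≡ c + (b + t) + (a + a)
  regroup = solve-∀
  regroup′ : ∀ p q → p + p + (q + q) ≡ p + q + (p + q)
  regroup′ = solve-∀

V⇒F≤α : ∀ {ℓ z} → V ℓ z → F ℓ ≤ α z
V⇒F≤α {ℓ} (a , αz≡a , Fℓ≤a) = subst (F ℓ ≤_) (AlphaIs⇒≡α αz≡a) Fℓ≤a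

F≤α⇒V : ∀ {ℓ z} → F ℓ ≤ α z → V ℓ z
F≤α⇒V {z = z} Fℓ≤αz = α z , α-spec z , Fℓ≤αz

V-resp-α : ∀ {ℓ z w} → α z ≡ α w → V ℓ z → V ℓ w
V-resp-α {ℓ} αz≡αw z∈V = F≤α⇒V {ℓ} (subst (F ℓ ≤_) αz≡αw (V⇒F≤α {ℓ} z∈V))

V-fib : ∀ {ℓ i} → ℓ ≤ i → V ℓ (F i)
V-fib {ℓ} {i} ℓ≤i = F≤α⇒V {ℓ} (subst (F ℓ ≤_) (sym (α-fib i)) (F-mono-≤ ℓ≤i))

succ-least : ∀ {ℓ x y w} → Consecutive ℓ x y → x < w → V ℓ w → y ≤ w
succ-least (_ , _ , _ , gap) x<w w∈V = ≮⇒≥ λ w<y → gap _ x<w w<y w∈V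

pred-greatest : ∀ {ℓ x y w} → Consecutive ℓ x y → w < y → V ℓ w → w ≤ x
pred-greatest (_ , _ , _ , gap) w<y w∈V = ≮⇒≥ λ x<w → gap _ x<w w<y w∈V

-- The neighbours of F k and of F (1 + k) in V ℓ are found within these margins.
record RightMargin (ℓ k : ℕ) : Set where
  constructor rightMargin
  field
    g           : ℕ
    0<g         : 0 < g
    g<F         : g < F (2 + k)
    reaches     : F ℓ ≤ α (F k + g)
    stays-below : ∀ {t} → 0 < t → t ≤ g → α (F k + t) < F (2 + ℓ)

record LeftMargin (ℓ k : ℕ) : Set where
  constructor leftMargin
  field
    d           : ℕ
    0<d         : 0 < d
    d<F         : d < F k
    reaches     : F ℓ ≤ α (F (1 + k) ∸ d)
    stays-below : ∀ {e} → 0 < e → e ≤ d → α (F (1 + k) ∸ e) < F (2 + ℓ)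

right-margin-step : ∀ {ℓ k} → RightMargin ℓ k → RightMargin ℓ (3 + k)
right-margin-step {ℓ} {k} (rightMargin g 0<g g<F reaches stays-below) =
  rightMargin g 0<g (<-≤-trans g<F (F-mono-≤ (m≤n+m (2 + k) 3)))
    (subst (F ℓ ≤_) (sym (α-shift k 0<g g<F)) reaches)
    (λ 0<t t≤g → subst (_< F (2 + ℓ)) (sym (α-shift k 0<t (≤-<-trans t≤g g<F)))
                       (stays-below 0<t t≤g))

left-margin-step : ∀ {ℓ k} → LeftMargin ℓ k → LeftMargin ℓ (3 + k)
left-margin-step {ℓ} {k} (leftMargin d 0<d d<F reaches stays-below) =
  leftMargin d 0<d (<-≤-trans d<F (F-mono-≤ (m≤n+m k 3)))
    (subst (F ℓ ≤_) (sym (α-shiftʳ k 0<d d<F)) reaches)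
    (λ 0<e e≤d → subst (_< F (2 + ℓ)) (sym (α-shiftʳ k 0<e (≤-<-trans e≤d d<F)))
                       (stays-below 0<e e≤d))

right-margin : ∀ {m k} → 2 + m ≤ k → RightMargin (2 + m) k
right-margin {m} {k} ℓ≤k = subst (RightMargin (2 + m)) (m∸n+n≡m ℓ≤k) (margin (k ∸ (2 + m)))
  where
  margin : ∀ r → RightMargin (2 + m) (r + (2 + m))
  margin 0 = rightMargin (F (1 + m)) (F-pos (1 + m)) (F-mono-< (m≤n+m (3 + m) 1))
    (subst (F (2 + m) ≤_) (sym (α-fib (3 + m))) (F-≤-suc (2 + m)))
    (λ _ t≤g → α-< (≤-<-trans (+-monoʳ-≤ (F (2 + m)) t≤g) (F-<-suc (2 + m))))
  margin 1 = rightMargin (F (1 + m)) (F-pos (1 + m)) (F-mono-< (m≤n+m (3 + m) 2))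
    (≤-reflexive (sym (begin
      α (F (3 + m) + F (1 + m)) ≡⟨ α-shift m (F-pos (1 + m)) (F-<-suc m) ⟩
      α (F m + F (1 + m))       ≡⟨ cong α (+-comm (F m) (F (1 + m))) ⟩
      α (F (2 + m))             ≡⟨ α-fib (2 + m) ⟩
      F (2 + m)                 ∎)))
    (λ _ t≤g → α-< (≤-<-trans (+-monoʳ-≤ (F (3 + m)) t≤g) (+-monoʳ-< (F (3 + m)) (F-<-suc m))))
    where open ≡-Reasoning
  margin 2 = rightMargin (F m) (F-pos m) (F-mono-< (m≤n+m (2 + m) 4))
    (≤-reflexive (sym (trans (α-shift (1 + m) (F-pos m) Fm<F[3+m]) (α-fib (2 + m)))))
    (λ 0<t t≤g → α-interior {4 + m} (m<m+n _ 0<t)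
                   (+-monoʳ-< (F (4 + m)) (≤-<-trans t≤g Fm<F[3+m])))
    where
    Fm<F[3+m] : F m < F (3 + m)
    Fm<F[3+m] = F-mono-< (m≤n+m (2 + m) 1)
  margin (suc (suc (suc r))) = right-margin-step (margin r)

left-margin : ∀ {m k} → 2 + m ≤ k → LeftMargin (2 + m) k
left-margin {m} {k} ℓ≤k = subst (LeftMargin (2 + m)) (m∸n+n≡m ℓ≤k) (margin (k ∸ (2 + m)))
  where
  margin : ∀ r → LeftMargin (2 + m) (r + (2 + m))
  margin 0 = leftMargin (F (1 + m)) (F-pos (1 + m)) (F-<-suc m)
    (subst (F (2 + m) ≤_) (sym (trans (cong α (m+n∸n≡m (F (2 + m)) (F (1 + m)))) (α-fib (2 + m))))
      ≤-refl)
    (λ {e} _ _ → α-< (≤-<-trans (m∸n≤m (F (3 + m)) e) (F-<-suc (2 + m))))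
  margin 1 = leftMargin (F (2 + m)) (F-pos (2 + m)) (F-<-suc (1 + m))
    (subst (F (2 + m) ≤_) (sym (trans (cong α (m+n∸n≡m (F (3 + m)) (F (2 + m)))) (α-fib (3 + m))))
      (F-≤-suc (2 + m)))
    (λ 0<e e≤d → α-< (∸-monoʳ-< 0<e (≤-trans e≤d (F-mono-≤ (m≤n+m (2 + m) 2)))))
  margin 2 = leftMargin (F (1 + m)) (F-pos (1 + m)) (F-mono-< (m≤n+m (3 + m) 1))
    (≤-trans (F-≤-suc (2 + m)) (≤-reflexive (sym (begin
      α (F (5 + m) ∸ F (1 + m))
        ≡⟨ cong α (+-∸-assoc (F (4 + m)) (m≤n+m (F (1 + m)) (F (2 + m)))) ⟩
      α (F (4 + m) + (F (2 + m) + F (1 + m) ∸ F (1 + m)))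
        ≡⟨ cong (λ w → α (F (4 + m) + w)) (m+n∸n≡m (F (2 + m)) (F (1 + m))) ⟩
      α (F (4 + m) + F (2 + m))
        ≡⟨ α-shift (1 + m) (F-pos (2 + m)) (F-<-suc (1 + m)) ⟩
      α (F (1 + m) + F (2 + m))
        ≡⟨ cong α (+-comm (F (1 + m)) (F (2 + m))) ⟩
      α (F (3 + m))
        ≡⟨ α-fib (3 + m) ⟩
      F (3 + m)
        ∎))))
    (λ {e} 0<e e≤d → α-interior {4 + m}
      (m+n≤o⇒m≤o∸n (suc (F (4 + m)))
        (+-monoʳ-< (F (4 + m)) (≤-<-trans e≤d (F-mono-< (m≤n+m (3 + m) 0)))))
      (∸-monoʳ-< 0<e (≤-trans e≤d (F-mono-≤ (m≤n+m (1 + m) 4)))))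
    where open ≡-Reasoning
  margin (suc (suc (suc r))) = left-margin-step (margin r)

Consecutive-lower : ∀ {ℓ j s t} → 0 < s → t < F (2 + j)
  → Consecutive ℓ (F (3 + j) + s) (F (3 + j) + t) → Consecutive ℓ (F j + s) (F j + t)
Consecutive-lower {ℓ} {j} {s} {t} 0<s t<F (x<y , x∈V , y∈V , gap) =
  +-monoʳ-< (F j) s<t , V-resp-α {ℓ} (α-shift j 0<s (<-trans s<t t<F)) x∈V ,
  V-resp-α {ℓ} (α-shift j (<-trans 0<s s<t) t<F) y∈V , gap′
  where
  s<t : s < t
  s<t = +-cancelˡ-< (F (3 + j)) s t x<y
  gap′ : ∀ z → F j + s < z → z < F j + t → ¬ V ℓ z
  gap′ z lo hi with ∃-offset (F j) lo hi
  ... | u , refl , s<u , u<t = λ z∈V → gap (F (3 + j) + u) (+-monoʳ-< _ s<u) (+-monoʳ-< _ u<t)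
        (V-resp-α {ℓ} (sym (α-shift j (<-trans 0<s s<u) (<-trans u<t t<F))) z∈V)

consecutive-block : ∀ {ℓ x y} → Consecutive ℓ x y
  → ∃[ k ] ℓ ≤ k × F k ≤ x × x < F (1 + k) × y ≤ F (1 + k)
consecutive-block {ℓ} {x} {y} c@(_ , x∈V , _) = in-block (block-of x (≤-trans (F-pos ℓ) Fℓ≤x))
  where
  Fℓ≤x : F ℓ ≤ x
  Fℓ≤x = ≤-trans (V⇒F≤α {ℓ} x∈V) (α-≤ x)
  in-block : ∃[ k ] F k ≤ x × x < F (1 + k)
    → ∃[ k ] ℓ ≤ k × F k ≤ x × x < F (1 + k) × y ≤ F (1 + k)
  in-block (k , Fk≤x , x<F) =
    k , ℓ≤k , Fk≤x , x<F , succ-least {ℓ} c x<F (V-fib {ℓ} (m≤n⇒m≤1+n ℓ≤k))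
    where
    ℓ≤k : ℓ ≤ k
    ℓ≤k = s≤s⁻¹ (F-cancel-< (≤-<-trans Fℓ≤x x<F))

-- Q sees only α x, α y and y ∸ x, which lowering a pair inside one block preserves.
consecutive-induction : ∀ ℓ (Q : ℕ → ℕ → ℕ → Set)
  → (∀ {k y} → ℓ ≤ k → Consecutive ℓ (F k) y → y < F (1 + k)
       → Q (α (F k)) (α y) (y ∸ F k))
  → (∀ {k x} → ℓ ≤ k → Consecutive ℓ x (F (1 + k))
       → Q (α x) (α (F (1 + k))) (F (1 + k) ∸ x))
  → ∀ {x y} → Consecutive ℓ x y → Q (α x) (α y) (y ∸ x)
consecutive-induction ℓ Q from-fib to-fib {y = y} = <-rec P step y
  where
  P : ℕ → Set
  P y = ∀ {x} → Consecutive ℓ x y → Q (α x) (α y) (y ∸ x)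
  lower : ∀ {k x y} → Interior k x → Interior k y → Consecutive ℓ x y
    → (∀ {y′} → y′ < y → P y′) → Q (α x) (α y) (y ∸ x)
  lower (interior j s 0<s _) (interior _ t 0<t t<F) c rec =
    subst₂ (λ a b → Q a b (F (3 + j) + t ∸ (F (3 + j) + s)))
      (sym (α-shift j 0<s (<-trans s<t t<F))) (sym (α-shift j 0<t t<F))
      (subst (Q (α (F j + s)) (α (F j + t)))
        (trans ([m+n]∸[m+o]≡n∸o (F j) t s) (sym ([m+n]∸[m+o]≡n∸o (F (3 + j)) t s)))
        (rec (+-monoˡ-< t (F-mono-< {j} (n≤1+n (2 + j)))) (Consecutive-lower {ℓ} {j} 0<s t<F c)))
    where
    s<t : s < t
    s<t = +-cancelˡ-< (F (3 + j)) s t (proj₁ c)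
  step : ∀ y → (∀ {y′} → y′ < y → P y′) → P y
  step y rec {x} c with consecutive-block c
  ... | k , ℓ≤k , Fk≤x , x<F , y≤F with m≤n⇒m<n∨m≡n y≤F | m≤n⇒m<n∨m≡n Fk≤x
  ...   | inj₂ refl | _ = to-fib ℓ≤k c
  ...   | inj₁ y<F | inj₂ refl = from-fib ℓ≤k c y<F
  ...   | inj₁ y<F | inj₁ Fk<x =
    lower (interior-view {k} Fk<x x<F) (interior-view {k} (<-trans Fk<x (proj₁ c)) y<F) c rec

consecutive-α-below : ∀ {ℓ x y} → 2 ≤ ℓ → Consecutive ℓ x y → α x < F (2 + ℓ) ⊎ α y < F (2 + ℓ)
consecutive-α-below {suc (suc m)} (s≤s (s≤s z≤n)) =
  consecutive-induction ℓ (λ a b _ → a < F (2 + ℓ) ⊎ b < F (2 + ℓ)) from-fib to-fib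
  where
  ℓ : ℕ
  ℓ = 2 + m
  from-fib : ∀ {k y} → ℓ ≤ k → Consecutive ℓ (F k) y → y < F (1 + k)
    → α (F k) < F (2 + ℓ) ⊎ α y < F (2 + ℓ)
  from-fib {k} {y} ℓ≤k c _ with right-margin ℓ≤k
  ... | rightMargin g 0<g _ reaches stays-below =
    inj₂ (subst (_< F (2 + ℓ)) (cong α (m+[n∸m]≡n (<⇒≤ (proj₁ c))))
      (stays-below (m<n⇒0<n∸m (proj₁ c)) (m≤n+o⇒m∸n≤o y (F k) y≤F+g)))
    where
    y≤F+g : y ≤ F k + g
    y≤F+g = succ-least {ℓ} c (m<m+n (F k) 0<g) (F≤α⇒V {ℓ} reaches)
  to-fib : ∀ {k x} → ℓ ≤ k → Consecutive ℓ x (F (1 + k))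
    → α x < F (2 + ℓ) ⊎ α (F (1 + k)) < F (2 + ℓ)
  to-fib {k} {x} ℓ≤k c with left-margin ℓ≤k
  ... | leftMargin d 0<d d<F reaches stays-below =
    inj₁ (subst (_< F (2 + ℓ)) (cong α (m∸[m∸n]≡n (<⇒≤ (proj₁ c))))
      (stays-below (m<n⇒0<n∸m (proj₁ c)) e≤d))
    where
    d≤F : d ≤ F (1 + k)
    d≤F = ≤-trans (<⇒≤ d<F) (F-≤-suc k)
    e≤d : F (1 + k) ∸ x ≤ d
    e≤d = subst (F (1 + k) ∸ x ≤_) (m∸[m∸n]≡n d≤F)
            (∸-monoʳ-≤ (F (1 + k)) (pred-greatest {ℓ} c (∸-monoʳ-< 0<d d≤F) (F≤α⇒V {ℓ} reaches)))

consecutive-α-reaches : ∀ {ℓ x y} → Consecutive ℓ x y → F (1 + ℓ) ≤ α x ⊎ F (1 + ℓ) ≤ α y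
consecutive-α-reaches {ℓ} =
  consecutive-induction ℓ (λ a b _ → F (1 + ℓ) ≤ a ⊎ F (1 + ℓ) ≤ b) from-fib to-fib
  where
  from-fib : ∀ {k y} → ℓ ≤ k → Consecutive ℓ (F k) y → y < F (1 + k)
    → F (1 + ℓ) ≤ α (F k) ⊎ F (1 + ℓ) ≤ α y
  from-fib {k} ℓ≤k (Fk<y , _ , y∈V , _) y<F with m≤n⇒m<n∨m≡n ℓ≤k
  ... | inj₁ ℓ<k = inj₁ (subst (F (1 + ℓ) ≤_) (sym (α-fib k)) (F-mono-≤ ℓ<k))
  ... | inj₂ refl = contradiction (V⇒F≤α {ℓ} y∈V) (<⇒≱ (α-interior {ℓ} Fk<y y<F))
  to-fib : ∀ {k x} → ℓ ≤ k → Consecutive ℓ x (F (1 + k))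
    → F (1 + ℓ) ≤ α x ⊎ F (1 + ℓ) ≤ α (F (1 + k))
  to-fib {k} ℓ≤k _ = inj₂ (subst (F (1 + ℓ) ≤_) (sym (α-fib (1 + k))) (F-mono-≤ (s≤s ℓ≤k)))

m+n≤o+o⇒n∸o≤o∸m : ∀ {m n o} → m + n ≤ o + o → n ∸ o ≤ o ∸ m
m+n≤o+o⇒n∸o≤o∸m {m} {n} {o} m+n≤o+o = begin
  n ∸ o             ≤⟨ ∸-monoˡ-≤ o (m+n≤o⇒m≤o∸n n (subst (_≤ o + o) (+-comm m n) m+n≤o+o)) ⟩
  o + o ∸ m ∸ o     ≡⟨ ∸-+-assoc (o + o) m o ⟩
  o + o ∸ (m + o)   ≡⟨ cong (o + o ∸_) (+-comm m o) ⟩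
  o + o ∸ (o + m)   ≡⟨ [m+n]∸[m+o]≡n∸o o o m ⟩
  o ∸ m             ∎
  where open ≤-Reasoning

consecutive-gap : ∀ {ℓ x y} → Consecutive ℓ x y → y ∸ x ≤ ∣ α y - α x ∣
consecutive-gap {ℓ} = consecutive-induction ℓ (λ a b δ → δ ≤ ∣ b - a ∣) from-fib to-fib
  where
  open ≤-Reasoning
  from-fib : ∀ {k y} → ℓ ≤ k → Consecutive ℓ (F k) y → y < F (1 + k)
    → y ∸ F k ≤ ∣ α y - α (F k) ∣
  from-fib {k} {y} _ _ y<F = begin
    y ∸ F k           ≤⟨ m+n≤o+o⇒n∸o≤o∸m {α y} {y} {F k} (α-tent k y<F) ⟩
    F k ∸ α y         ≤⟨ m∸n≤∣m-n∣ (F k) (α y) ⟩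
    ∣ F k - α y ∣     ≡⟨ ∣-∣-comm (F k) (α y) ⟩
    ∣ α y - F k ∣     ≡⟨ cong (λ a → ∣ α y - a ∣) (sym (α-fib k)) ⟩
    ∣ α y - α (F k) ∣ ∎
  to-fib : ∀ {k x} → ℓ ≤ k → Consecutive ℓ x (F (1 + k))
    → F (1 + k) ∸ x ≤ ∣ α (F (1 + k)) - α x ∣
  to-fib {k} {x} _ _ = begin
    F (1 + k) ∸ x           ≤⟨ ∸-monoʳ-≤ (F (1 + k)) (α-≤ x) ⟩
    F (1 + k) ∸ α x         ≤⟨ m∸n≤∣m-n∣ (F (1 + k)) (α x) ⟩
    ∣ F (1 + k) - α x ∣     ≡⟨ cong (λ a → ∣ a - α x ∣) (sym (α-fib (1 + k))) ⟩
    ∣ α (F (1 + k)) - α x ∣ ∎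

corollary4p9 : ∀ (ℓ x y : ℕ) → 2 ≤ ℓ → Consecutive ℓ x y →
    (¬ (V (ℓ + 2) x × V (ℓ + 2) y))
    × (V (ℓ + 1) x ⊎ V (ℓ + 1) y)
    × (∀ ax ay → AlphaIs x ax → AlphaIs y ay → y ∸ x ≤ ∣ ay - ax ∣)
corollary4p9 ℓ x y 2≤ℓ c = not-both , map into-V into-V (consecutive-α-reaches {ℓ} c) , gap
  where
  F[ℓ+n]≡F[n+ℓ] : ∀ n → F (ℓ + n) ≡ F (n + ℓ)
  F[ℓ+n]≡F[n+ℓ] n = cong F (+-comm ℓ n)
  out-of-V : ∀ {z} → V (ℓ + 2) z → ¬ α z < F (2 + ℓ)
  out-of-V z∈V = ≤⇒≯ (subst (_≤ _) (F[ℓ+n]≡F[n+ℓ] 2) (V⇒F≤α {ℓ + 2} z∈V))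
  not-both : ¬ (V (ℓ + 2) x × V (ℓ + 2) y)
  not-both (x∈V , y∈V) = [ out-of-V x∈V , out-of-V y∈V ] (consecutive-α-below 2≤ℓ c)
  into-V : ∀ {z} → F (1 + ℓ) ≤ α z → V (ℓ + 1) z
  into-V F≤αz = F≤α⇒V {ℓ + 1} (subst (_≤ _) (sym (F[ℓ+n]≡F[n+ℓ] 1)) F≤αz)
  gap : ∀ ax ay → AlphaIs x ax → AlphaIs y ay → y ∸ x ≤ ∣ ay - ax ∣
  gap ax ay x↦ax y↦ay = subst₂ (λ a b → y ∸ x ≤ ∣ b - a ∣)
    (sym (AlphaIs⇒≡α x↦ax)) (sym (AlphaIs⇒≡α y↦ay)) (consecutive-gap {ℓ} c)
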